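{- For every $\lambda$-variable $x$, term $t$ and value $v$, $(\lambda x\,t)\,v\equiv t[x:=v]$; and for all constructors $C_1,\dots,C_n$, $\lambda$-variables $x_1,\dots,x_n$, terms $t_1,\dots,t_n$, value $v$ and every $k$ with $1\le k\le n$, $\mathrm{case}_{C_k[v]}[C_i[x_i]\to t_i]_{1\le i\le n}\equiv t_k[x_k:=v]$.
   Context: Fix pairwise disjoint countably infinite sets of $\lambda$-variables ($x,y,\dots$), stack variables ($\alpha,\beta,\dots$), term variables ($a,b,\dots$), and countable sets of labels $l$ and constructors $C$. Values, terms, stacks, processes: $v,w::=x\mid\lambda x\,t\mid C[v]\mid\{l_i=v_i\}_{i\in I}$; $t,u::=a\mid v\mid t\,u\mid\mu\alpha\,t\mid p\mid v.l\mid\mathrm{case}_v[C_i[x_i]\to t_i]_{i\in I}\mid\delta_{v,w}$; $\pi::=\alpha\mid v.\pi\mid[t]\pi$; $p::=t\ast\pi$; $I$ finite; $\lambda x$, $\mu\alpha$ and the $x_i$ in case branches are binders, term variables are never bound. Substitutions map $\lambda$-variables to values, stack variables to stacks, term variables to terms (capture-avoiding). $\succ$ is the smallest relation on processes with: $t\,u\ast\pi\succ u\ast[t]\pi$; $v\ast[t]\pi\succ t\ast v.\pi$; $\lambda x\,t\ast v.\pi\succ t[x:=v]\ast\pi$; $\mu\alpha\,t\ast\pi\succ t[\alpha:=\pi]\ast\pi$; $p\ast\pi\succ p$; $\{l_i=v_i\}_{i\in I}.l_k\ast\pi\succ v_k\ast\pi$ ($k\in I$); $\mathrm{case}_{C_k[v]}[C_i[x_i]\to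 t_i]_{i\in I}\ast\pi\succ t_k[x_k:=v]\ast\pi$ ($k\in I$). A process is final if it is $v\ast\alpha$ with $v$ a value and $\alpha$ a stack variable; for a relation $R$, $p\Downarrow_R$ means $p\,R^*\,q$ with $q$ final. For $i\in\mathbb N$, inductively: $\rightsquigarrow_i=\succ\cup\{(\delta_{v,w}\ast\pi,v\ast\pi)\mid\exists j<i,\ v\not\equiv_jw\}$; $t\equiv_iu$ iff for all $j\le i$, stacks $\pi$, substitutions $\sigma$: $t\sigma\ast\pi\Downarrow_{\rightsquigarrow_j}\Leftrightarrow u\sigma\ast\pi\Downarrow_{\rightsquigarrow_j}$; $\not\equiv_i$ is its negation. $\equiv=\bigcap_i\equiv_i$. -}

module Defs where

open import Data.Nat using (ℕ; zero; suc; _≤_; _<_; z≤n; s≤s)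
open import Data.Nat.Properties using (m<1+n⇒m<n∨m≡n; ≤-refl; ≤-trans; n≤1+n; <⇒≤)
open import Data.Product using (Σ; Σ-syntax; ∃; _×_; _,_; proj₁; proj₂)
open import Data.Sum using (_⊎_; inj₁; inj₂)
open import Relation.Nullary using (¬_)
open import Relation.Binary.PropositionalEquality using (_≡_; refl)
open import Relation.Binary.Construct.Closure.ReflexiveTransitive using (Star)
open import Function.Bundles using (_⇔_; mk⇔)
import Data.Vec
import Data.Nat.Properties

-- Syntax.  λ-variables and stack variables are de Bruijn indices
-- (ℕ); term variables are names (ℕ) and are never bound.  In a branch the bound λ-variable x_i is de Bruijn index 0.

mutual
  data Val : Set where
    var : ℕ → Val
    lam : Term → Val
    con : ℕ → Val → Val
    rec : Fields → Val

  data Fields : Set where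
    fnil  : Fields
    fcons : ℕ → Val → Fields → Fields

  data Term : Set where
    tvar  : ℕ → Term
    val   : Val → Term
    app   : Term → Term → Term
    mu    : Term → Term           -- μα t   (α = index 0)
    proc  : Proc → Term
    proj  : Val → ℕ → Term
    case  : Val → Branches → Term
    delta : Val → Val → Term

  data Branches : Set where
    bnil  : Branches
    bcons : ℕ → Term → Branches → Branches

  data Stack : Set where
    svar  : ℕ → Stack
    push  : Val → Stack → Stack
    frame : Term → Stack → Stack

  data Proc : Set where
    _∗_ : Term → Stack → Proc

infix 4 _∗_

record Ren : Set where
  field
    rλ : ℕ → ℕ
    rs : ℕ → ℕ
open Ren public

ext : (ℕ → ℕ) → ℕ → ℕ
ext f zero    = zero
ext f (suc n) = suc (f n)

liftRλ : Ren → Ren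
liftRλ ρ = record { rλ = ext (rλ ρ) ; rs = rs ρ }

liftRs : Ren → Ren
liftRs ρ = record { rλ = rλ ρ ; rs = ext (rs ρ) }

mutual
  renV : Ren → Val → Val
  renV ρ (var x)   = var (rλ ρ x)
  renV ρ (lam t)   = lam (renT (liftRλ ρ) t)
  renV ρ (con c v) = con c (renV ρ v)
  renV ρ (rec fs)  = rec (renF ρ fs)

  renF : Ren → Fields → Fields
  renF ρ fnil          = fnil
  renF ρ (fcons l v f) = fcons l (renV ρ v) (renF ρ f)

  renT : Ren → Term → Term
  renT ρ (tvar a)    = tvar a
  renT ρ (val v)     = val (renV ρ v)
  renT ρ (app t u)   = app (renT ρ t) (renT ρ u)
  renT ρ (mu t)      = mu (renT (liftRs ρ) t)
  renT ρ (proc p)    = proc (renP ρ p)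
  renT ρ (proj v l)  = proj (renV ρ v) l
  renT ρ (case v bs) = case (renV ρ v) (renB ρ bs)
  renT ρ (delta v w) = delta (renV ρ v) (renV ρ w)

  renB : Ren → Branches → Branches
  renB ρ bnil            = bnil
  renB ρ (bcons c t bs)  = bcons c (renT (liftRλ ρ) t) (renB ρ bs)

  renS : Ren → Stack → Stack
  renS ρ (svar α)    = svar (rs ρ α)
  renS ρ (push v π)  = push (renV ρ v) (renS ρ π)
  renS ρ (frame t π) = frame (renT ρ t) (renS ρ π)

  renP : Ren → Proc → Proc
  renP ρ (t ∗ π) = renT ρ t ∗ renS ρ π

wkλ : Ren
wkλ = record { rλ = suc ; rs = λ n → n }

wks : Ren
wks = record { rλ = λ n → n ; rs = suc }

record Subst : Set where
  field
    sλ : ℕ → Val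
    ss : ℕ → Stack
    st : ℕ → Term
open Subst public

liftσλ : Subst → Subst
liftσλ σ = record
  { sλ = λ { zero → var zero ; (suc n) → renV wkλ (sλ σ n) }
  ; ss = λ n → renS wkλ (ss σ n)
  ; st = λ a → renT wkλ (st σ a) }

liftσs : Subst → Subst
liftσs σ = record
  { sλ = λ n → renV wks (sλ σ n)
  ; ss = λ { zero → svar zero ; (suc n) → renS wks (ss σ n) }
  ; st = λ a → renT wks (st σ a) }

mutual
  subV : Subst → Val → Val
  subV σ (var x)   = sλ σ x
  subV σ (lam t)   = lam (subT (liftσλ σ) t)
  subV σ (con c v) = con c (subV σ v)
  subV σ (rec fs)  = rec (subF σ fs)

  subF : Subst → Fields → Fields
  subF σ fnil          = fnil
  subF σ (fcons l v f) = fcons l (subV σ v) (subF σ f)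

  subT : Subst → Term → Term
  subT σ (tvar a)    = st σ a
  subT σ (val v)     = val (subV σ v)
  subT σ (app t u)   = app (subT σ t) (subT σ u)
  subT σ (mu t)      = mu (subT (liftσs σ) t)
  subT σ (proc p)    = proc (subP σ p)
  subT σ (proj v l)  = proj (subV σ v) l
  subT σ (case v bs) = case (subV σ v) (subB σ bs)
  subT σ (delta v w) = delta (subV σ v) (subV σ w)

  subB : Subst → Branches → Branches
  subB σ bnil           = bnil
  subB σ (bcons c t bs) = bcons c (subT (liftσλ σ) t) (subB σ bs)

  subS : Subst → Stack → Stack
  subS σ (svar α)    = ss σ α
  subS σ (push v π)  = push (subV σ v) (subS σ π)
  subS σ (frame t π) = frame (subT σ t) (subS σ π)

  subP : Subst → Proc → Proc
  subP σ (t ∗ π) = subT σ t ∗ subS σ π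

_[0≔_] : Term → Val → Term
t [0≔ v ] = subT (record { sλ = λ { zero → v ; (suc n) → var n } ; ss = svar ; st = tvar }) t

_[0≔ₛ_] : Term → Stack → Term
t [0≔ₛ π ] = subT (record { sλ = var ; ss = λ { zero → π ; (suc n) → svar n } ; st = tvar }) t

data _↦_∈F_ : ℕ → Val → Fields → Set where
  here  : ∀ {l v f} → l ↦ v ∈F fcons l v f
  there : ∀ {l v l' v' f} → l ↦ v ∈F f → l ↦ v ∈F fcons l' v' f

data _↦_∈B_ : ℕ → Term → Branches → Set where
  here  : ∀ {c t bs} → c ↦ t ∈B bcons c t bs
  there : ∀ {c t c' t' bs} → c ↦ t ∈B bs → c ↦ t ∈B bcons c' t' bs

infix 3 _≻_
data _≻_ : Proc → Proc → Set where
  ≻-app   : ∀ {t u π} → app t u ∗ π ≻ u ∗ frame t π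
  ≻-ret   : ∀ {v t π} → val v ∗ frame t π ≻ t ∗ push v π
  ≻-beta  : ∀ {t v π} → val (lam t) ∗ push v π ≻ (t [0≔ v ]) ∗ π
  ≻-mu    : ∀ {t π} → mu t ∗ π ≻ (t [0≔ₛ π ]) ∗ π
  ≻-proc  : ∀ {p π} → proc p ∗ π ≻ p
  ≻-proj  : ∀ {fs l v π} → l ↦ v ∈F fs → proj (rec fs) l ∗ π ≻ val v ∗ π
  ≻-case  : ∀ {c v bs t π} → c ↦ t ∈B bs → case (con c v) bs ∗ π ≻ (t [0≔ v ]) ∗ π

data Final : Proc → Set where
  final : ∀ v α → Final (val v ∗ svar α)

Halts : (Proc → Proc → Set) → Proc → Set
Halts R p = Σ[ q ∈ Proc ] (Star R p q × Final q)

data DeltaStep (N : Val → Val → Set) : Proc → Proc → Set where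
  dstep : ∀ {v w π} → N v w → DeltaStep N (delta v w ∗ π) (val v ∗ π)

-- ↝_i and ≡_i, defined by (structural) mutual recursion on i.
--   Step (suc i) = Step i ∪ {δ-steps with v ≢_i w}
--   Equiv (suc i) = Equiv i ∩ Agree (suc i)
-- See Step-spec / Equiv-spec below for the literal definitions of the paper.

mutual
  Step : ℕ → Proc → Proc → Set
  Step zero    p q = p ≻ q
  Step (suc i) p q = Step i p q ⊎ DeltaStep (λ v w → ¬ Equiv i (val v) (val w)) p q

  Agree : ℕ → Term → Term → Set
  Agree j t u = ∀ (π : Stack) (σ : Subst) →
    Halts (Step j) (subT σ t ∗ π) ⇔ Halts (Step j) (subT σ u ∗ π)

  Equiv : ℕ → Term → Term → Set
  Equiv zero    t u = Agree zero t u
  Equiv (suc i) t u = Equiv i t u × Agree (suc i) t u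

infix 4 _≡obs_
_≡obs_ : Term → Term → Set
t ≡obs u = ∀ i → Equiv i t u

Equiv-spec : ∀ i t u → Equiv i t u ⇔ (∀ j → j ≤ i → Agree j t u)
Equiv-spec i t u = mk⇔ (to i) (from i)
  where
  to : ∀ i → Equiv i t u → ∀ j → j ≤ i → Agree j t u
  to zero    e .zero z≤n = e
  to (suc i) (e , a) j j≤ with m<1+n⇒m<n∨m≡n (s≤s j≤)
  ... | inj₁ j<1+i = to i e j (Data.Nat.Properties.≤-pred j<1+i)
  ... | inj₂ refl  = a
  from : ∀ i → (∀ j → j ≤ i → Agree j t u) → Equiv i t u
  from zero    h = h zero z≤n
  from (suc i) h = from i (λ j j≤ → h j (≤-trans j≤ (n≤1+n i))) , h (suc i) ≤-refl

Step-spec : ∀ i p q → Step i p q ⇔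
  (p ≻ q ⊎ Σ[ j ∈ ℕ ] (j < i × DeltaStep (λ v w → ¬ Equiv j (val v) (val w)) p q))
Step-spec i p q = mk⇔ (to i) (from i)
  where
  to : ∀ i → Step i p q → p ≻ q ⊎ Σ[ j ∈ ℕ ] (j < i × DeltaStep (λ v w → ¬ Equiv j (val v) (val w)) p q)
  to zero s = inj₁ s
  to (suc i) (inj₁ s) with to i s
  ... | inj₁ r = inj₁ r
  ... | inj₂ (j , j<i , d) = inj₂ (j , ≤-trans j<i (n≤1+n i) , d)
  to (suc i) (inj₂ d) = inj₂ (i , ≤-refl , d)
  from : ∀ i → (p ≻ q ⊎ Σ[ j ∈ ℕ ] (j < i × DeltaStep (λ v w → ¬ Equiv j (val v) (val w)) p q)) → Step i p q
  from zero    (inj₁ r) = r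
  from zero    (inj₂ (j , () , d))
  from (suc i) (inj₁ r) = inj₁ (from i (inj₁ r))
  from (suc i) (inj₂ (j , j<1+i , d)) with m<1+n⇒m<n∨m≡n j<1+i
  ... | inj₁ j<i  = inj₁ (from i (inj₂ (j , j<i , d)))
  ... | inj₂ refl = inj₂ d

branches : ∀ {n} → Data.Vec.Vec ℕ n → Data.Vec.Vec Term n → Branches
branches Data.Vec.[] Data.Vec.[] = bnil
branches (c Data.Vec.∷ cs) (t Data.Vec.∷ ts) = bcons c t (branches cs ts)

-- Under any substitution σ and on any stack π, the left-hand side reduces to
-- the right-hand side by ≻-steps each of which is the only ↝ⱼ-step available:
-- a ≻-redex is never a δ-redex, and injectivity of the constructor list leaves
-- a single matching case branch.  A step that is forced neither creates nor
-- destroys termination, so both sides agree at every level j.  The syntactic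
-- ingredient is that substitution commutes with instantiating the bound
-- variable: (t[x:=v])σ = (tσ⇑)[x:=vσ].

module Submission where

open import Defs
open import Data.Nat using (ℕ; zero; suc)
open import Data.Fin using (Fin; zero; suc)
open import Data.Fin.Properties using (suc-injective)
open import Data.Vec using (Vec; lookup; map; []; _∷_)
open import Data.Vec.Properties using (lookup-map)
open import Data.Product using (_×_; _,_; ∃)
open import Data.Sum using (inj₁; inj₂)
open import Data.Empty using (⊥-elim)
open import Relation.Nullary using (¬_)
open import Relation.Binary.PropositionalEquality
  using (_≡_; refl; sym; trans; cong; cong₂; subst; subst₂; module ≡-Reasoning)
open import Relation.Binary.Construct.Closure.ReflexiveTransitive using (Star; ε; _◅_)
open import Function.Definitions using (Injective)
open import Function.Bundles using (_⇔_; mk⇔; Equivalence)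
open import Function.Construct.Identity using (⇔-id)
open import Function.Construct.Composition using (_⇔-∘_)

record _≗ʳ_ (ρ ρ′ : Ren) : Set where
  field
    rλ≗ : ∀ n → rλ ρ n ≡ rλ ρ′ n
    rs≗ : ∀ n → rs ρ n ≡ rs ρ′ n
open _≗ʳ_

record _≗ˢ_ (σ τ : Subst) : Set where
  field
    sλ≗ : ∀ n → sλ σ n ≡ sλ τ n
    ss≗ : ∀ n → ss σ n ≡ ss τ n
    st≗ : ∀ a → st σ a ≡ st τ a
open _≗ˢ_

ext-cong : ∀ {f g : ℕ → ℕ} → (∀ n → f n ≡ g n) → ∀ n → ext f n ≡ ext g n
ext-cong e zero    = refl
ext-cong e (suc n) = cong suc (e n)

liftRλ-cong : ∀ {ρ ρ′} → ρ ≗ʳ ρ′ → liftRλ ρ ≗ʳ liftRλ ρ′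
liftRλ-cong e = record { rλ≗ = ext-cong (rλ≗ e) ; rs≗ = rs≗ e }

liftRs-cong : ∀ {ρ ρ′} → ρ ≗ʳ ρ′ → liftRs ρ ≗ʳ liftRs ρ′
liftRs-cong e = record { rλ≗ = rλ≗ e ; rs≗ = ext-cong (rs≗ e) }

mutual
  renV-cong : ∀ {ρ ρ′} → ρ ≗ʳ ρ′ → ∀ v → renV ρ v ≡ renV ρ′ v
  renV-cong e (var x)   = cong var (rλ≗ e x)
  renV-cong e (lam t)   = cong lam (renT-cong (liftRλ-cong e) t)
  renV-cong e (con c v) = cong (con c) (renV-cong e v)
  renV-cong e (rec fs)  = cong rec (renF-cong e fs)

  renF-cong : ∀ {ρ ρ′} → ρ ≗ʳ ρ′ → ∀ fs → renF ρ fs ≡ renF ρ′ fs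
  renF-cong e fnil          = refl
  renF-cong e (fcons l v f) = cong₂ (fcons l) (renV-cong e v) (renF-cong e f)

  renT-cong : ∀ {ρ ρ′} → ρ ≗ʳ ρ′ → ∀ t → renT ρ t ≡ renT ρ′ t
  renT-cong e (tvar a)    = refl
  renT-cong e (val v)     = cong val (renV-cong e v)
  renT-cong e (app t u)   = cong₂ app (renT-cong e t) (renT-cong e u)
  renT-cong e (mu t)      = cong mu (renT-cong (liftRs-cong e) t)
  renT-cong e (proc p)    = cong proc (renP-cong e p)
  renT-cong e (proj v l)  = cong (λ w → proj w l) (renV-cong e v)
  renT-cong e (case v bs) = cong₂ case (renV-cong e v) (renB-cong e bs)
  renT-cong e (delta v w) = cong₂ delta (renV-cong e v) (renV-cong e w)

  renB-cong : ∀ {ρ ρ′} → ρ ≗ʳ ρ′ → ∀ bs → renB ρ bs ≡ renB ρ′ bs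
  renB-cong e bnil           = refl
  renB-cong e (bcons c t bs) = cong₂ (bcons c) (renT-cong (liftRλ-cong e) t) (renB-cong e bs)

  renS-cong : ∀ {ρ ρ′} → ρ ≗ʳ ρ′ → ∀ π → renS ρ π ≡ renS ρ′ π
  renS-cong e (svar α)    = cong svar (rs≗ e α)
  renS-cong e (push v π)  = cong₂ push (renV-cong e v) (renS-cong e π)
  renS-cong e (frame t π) = cong₂ frame (renT-cong e t) (renS-cong e π)

  renP-cong : ∀ {ρ ρ′} → ρ ≗ʳ ρ′ → ∀ p → renP ρ p ≡ renP ρ′ p
  renP-cong e (t ∗ π) = cong₂ _∗_ (renT-cong e t) (renS-cong e π)

liftσλ-cong : ∀ {σ τ} → σ ≗ˢ τ → liftσλ σ ≗ˢ liftσλ τ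
liftσλ-cong e = record
  { sλ≗ = λ { zero → refl ; (suc n) → cong (renV wkλ) (sλ≗ e n) }
  ; ss≗ = λ n → cong (renS wkλ) (ss≗ e n)
  ; st≗ = λ a → cong (renT wkλ) (st≗ e a) }

liftσs-cong : ∀ {σ τ} → σ ≗ˢ τ → liftσs σ ≗ˢ liftσs τ
liftσs-cong e = record
  { sλ≗ = λ n → cong (renV wks) (sλ≗ e n)
  ; ss≗ = λ { zero → refl ; (suc n) → cong (renS wks) (ss≗ e n) }
  ; st≗ = λ a → cong (renT wks) (st≗ e a) }

mutual
  subV-cong : ∀ {σ τ} → σ ≗ˢ τ → ∀ v → subV σ v ≡ subV τ v
  subV-cong e (var x)   = sλ≗ e x
  subV-cong e (lam t)   = cong lam (subT-cong (liftσλ-cong e) t)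
  subV-cong e (con c v) = cong (con c) (subV-cong e v)
  subV-cong e (rec fs)  = cong rec (subF-cong e fs)

  subF-cong : ∀ {σ τ} → σ ≗ˢ τ → ∀ fs → subF σ fs ≡ subF τ fs
  subF-cong e fnil          = refl
  subF-cong e (fcons l v f) = cong₂ (fcons l) (subV-cong e v) (subF-cong e f)

  subT-cong : ∀ {σ τ} → σ ≗ˢ τ → ∀ t → subT σ t ≡ subT τ t
  subT-cong e (tvar a)    = st≗ e a
  subT-cong e (val v)     = cong val (subV-cong e v)
  subT-cong e (app t u)   = cong₂ app (subT-cong e t) (subT-cong e u)
  subT-cong e (mu t)      = cong mu (subT-cong (liftσs-cong e) t)
  subT-cong e (proc p)    = cong proc (subP-cong e p)
  subT-cong e (proj v l)  = cong (λ w → proj w l) (subV-cong e v)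
  subT-cong e (case v bs) = cong₂ case (subV-cong e v) (subB-cong e bs)
  subT-cong e (delta v w) = cong₂ delta (subV-cong e v) (subV-cong e w)

  subB-cong : ∀ {σ τ} → σ ≗ˢ τ → ∀ bs → subB σ bs ≡ subB τ bs
  subB-cong e bnil           = refl
  subB-cong e (bcons c t bs) = cong₂ (bcons c) (subT-cong (liftσλ-cong e) t) (subB-cong e bs)

  subS-cong : ∀ {σ τ} → σ ≗ˢ τ → ∀ π → subS σ π ≡ subS τ π
  subS-cong e (svar α)    = ss≗ e α
  subS-cong e (push v π)  = cong₂ push (subV-cong e v) (subS-cong e π)
  subS-cong e (frame t π) = cong₂ frame (subT-cong e t) (subS-cong e π)

  subP-cong : ∀ {σ τ} → σ ≗ˢ τ → ∀ p → subP σ p ≡ subP τ p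
  subP-cong e (t ∗ π) = cong₂ _∗_ (subT-cong e t) (subS-cong e π)

_∘ʳ_ : Ren → Ren → Ren
ρ ∘ʳ ρ′ = record { rλ = λ n → rλ ρ (rλ ρ′ n) ; rs = λ n → rs ρ (rs ρ′ n) }

ext-∘ : ∀ (f g : ℕ → ℕ) n → ext f (ext g n) ≡ ext (λ m → f (g m)) n
ext-∘ f g zero    = refl
ext-∘ f g (suc n) = refl

liftRλ-∘ : ∀ ρ ρ′ → (liftRλ ρ ∘ʳ liftRλ ρ′) ≗ʳ liftRλ (ρ ∘ʳ ρ′)
liftRλ-∘ ρ ρ′ = record { rλ≗ = ext-∘ (rλ ρ) (rλ ρ′) ; rs≗ = λ _ → refl }

liftRs-∘ : ∀ ρ ρ′ → (liftRs ρ ∘ʳ liftRs ρ′) ≗ʳ liftRs (ρ ∘ʳ ρ′)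
liftRs-∘ ρ ρ′ = record { rλ≗ = λ _ → refl ; rs≗ = ext-∘ (rs ρ) (rs ρ′) }

mutual
  renV-renV : ∀ ρ ρ′ v → renV ρ (renV ρ′ v) ≡ renV (ρ ∘ʳ ρ′) v
  renV-renV ρ ρ′ (var x)   = refl
  renV-renV ρ ρ′ (lam t)   = cong lam (trans (renT-renT _ _ t) (renT-cong (liftRλ-∘ ρ ρ′) t))
  renV-renV ρ ρ′ (con c v) = cong (con c) (renV-renV ρ ρ′ v)
  renV-renV ρ ρ′ (rec fs)  = cong rec (renF-renF ρ ρ′ fs)

  renF-renF : ∀ ρ ρ′ fs → renF ρ (renF ρ′ fs) ≡ renF (ρ ∘ʳ ρ′) fs
  renF-renF ρ ρ′ fnil          = refl
  renF-renF ρ ρ′ (fcons l v f) = cong₂ (fcons l) (renV-renV ρ ρ′ v) (renF-renF ρ ρ′ f)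

  renT-renT : ∀ ρ ρ′ t → renT ρ (renT ρ′ t) ≡ renT (ρ ∘ʳ ρ′) t
  renT-renT ρ ρ′ (tvar a)    = refl
  renT-renT ρ ρ′ (val v)     = cong val (renV-renV ρ ρ′ v)
  renT-renT ρ ρ′ (app t u)   = cong₂ app (renT-renT ρ ρ′ t) (renT-renT ρ ρ′ u)
  renT-renT ρ ρ′ (mu t)      = cong mu (trans (renT-renT _ _ t) (renT-cong (liftRs-∘ ρ ρ′) t))
  renT-renT ρ ρ′ (proc p)    = cong proc (renP-renP ρ ρ′ p)
  renT-renT ρ ρ′ (proj v l)  = cong (λ w → proj w l) (renV-renV ρ ρ′ v)
  renT-renT ρ ρ′ (case v bs) = cong₂ case (renV-renV ρ ρ′ v) (renB-renB ρ ρ′ bs)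
  renT-renT ρ ρ′ (delta v w) = cong₂ delta (renV-renV ρ ρ′ v) (renV-renV ρ ρ′ w)

  renB-renB : ∀ ρ ρ′ bs → renB ρ (renB ρ′ bs) ≡ renB (ρ ∘ʳ ρ′) bs
  renB-renB ρ ρ′ bnil           = refl
  renB-renB ρ ρ′ (bcons c t bs) =
    cong₂ (bcons c) (trans (renT-renT _ _ t) (renT-cong (liftRλ-∘ ρ ρ′) t)) (renB-renB ρ ρ′ bs)

  renS-renS : ∀ ρ ρ′ π → renS ρ (renS ρ′ π) ≡ renS (ρ ∘ʳ ρ′) π
  renS-renS ρ ρ′ (svar α)    = refl
  renS-renS ρ ρ′ (push v π)  = cong₂ push (renV-renV ρ ρ′ v) (renS-renS ρ ρ′ π)
  renS-renS ρ ρ′ (frame t π) = cong₂ frame (renT-renT ρ ρ′ t) (renS-renS ρ ρ′ π)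

  renP-renP : ∀ ρ ρ′ p → renP ρ (renP ρ′ p) ≡ renP (ρ ∘ʳ ρ′) p
  renP-renP ρ ρ′ (t ∗ π) = cong₂ _∗_ (renT-renT ρ ρ′ t) (renS-renS ρ ρ′ π)

module _ {ρ₁ ρ₂ ρ₃ ρ₄ : Ren} (square : (ρ₁ ∘ʳ ρ₂) ≗ʳ (ρ₃ ∘ʳ ρ₄)) where

  renV-square : ∀ v → renV ρ₁ (renV ρ₂ v) ≡ renV ρ₃ (renV ρ₄ v)
  renV-square v = trans (renV-renV _ _ v) (trans (renV-cong square v) (sym (renV-renV _ _ v)))

  renS-square : ∀ π → renS ρ₁ (renS ρ₂ π) ≡ renS ρ₃ (renS ρ₄ π)
  renS-square π = trans (renS-renS _ _ π) (trans (renS-cong square π) (sym (renS-renS _ _ π)))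

  renT-square : ∀ t → renT ρ₁ (renT ρ₂ t) ≡ renT ρ₃ (renT ρ₄ t)
  renT-square t = trans (renT-renT _ _ t) (trans (renT-cong square t) (sym (renT-renT _ _ t)))

_ʳ∘ˢ_ : Ren → Subst → Subst
ρ ʳ∘ˢ σ = record
  { sλ = λ n → renV ρ (sλ σ n) ; ss = λ n → renS ρ (ss σ n) ; st = λ a → renT ρ (st σ a) }

liftσλ-ʳ∘ˢ : ∀ ρ σ → (liftRλ ρ ʳ∘ˢ liftσλ σ) ≗ˢ liftσλ (ρ ʳ∘ˢ σ)
liftσλ-ʳ∘ˢ ρ σ = record
  { sλ≗ = λ { zero → refl ; (suc n) → renV-square weaken (sλ σ n) }
  ; ss≗ = λ n → renS-square weaken (ss σ n)
  ; st≗ = λ a → renT-square weaken (st σ a) }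
  where
  weaken : (liftRλ ρ ∘ʳ wkλ) ≗ʳ (wkλ ∘ʳ ρ)
  weaken = record { rλ≗ = λ _ → refl ; rs≗ = λ _ → refl }

liftσs-ʳ∘ˢ : ∀ ρ σ → (liftRs ρ ʳ∘ˢ liftσs σ) ≗ˢ liftσs (ρ ʳ∘ˢ σ)
liftσs-ʳ∘ˢ ρ σ = record
  { sλ≗ = λ n → renV-square weaken (sλ σ n)
  ; ss≗ = λ { zero → refl ; (suc n) → renS-square weaken (ss σ n) }
  ; st≗ = λ a → renT-square weaken (st σ a) }
  where
  weaken : (liftRs ρ ∘ʳ wks) ≗ʳ (wks ∘ʳ ρ)
  weaken = record { rλ≗ = λ _ → refl ; rs≗ = λ _ → refl }

mutual
  renV-subV : ∀ ρ σ v → renV ρ (subV σ v) ≡ subV (ρ ʳ∘ˢ σ) v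
  renV-subV ρ σ (var x)   = refl
  renV-subV ρ σ (lam t)   = cong lam (trans (renT-subT _ _ t) (subT-cong (liftσλ-ʳ∘ˢ ρ σ) t))
  renV-subV ρ σ (con c v) = cong (con c) (renV-subV ρ σ v)
  renV-subV ρ σ (rec fs)  = cong rec (renF-subF ρ σ fs)

  renF-subF : ∀ ρ σ fs → renF ρ (subF σ fs) ≡ subF (ρ ʳ∘ˢ σ) fs
  renF-subF ρ σ fnil          = refl
  renF-subF ρ σ (fcons l v f) = cong₂ (fcons l) (renV-subV ρ σ v) (renF-subF ρ σ f)

  renT-subT : ∀ ρ σ t → renT ρ (subT σ t) ≡ subT (ρ ʳ∘ˢ σ) t
  renT-subT ρ σ (tvar a)    = refl
  renT-subT ρ σ (val v)     = cong val (renV-subV ρ σ v)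
  renT-subT ρ σ (app t u)   = cong₂ app (renT-subT ρ σ t) (renT-subT ρ σ u)
  renT-subT ρ σ (mu t)      = cong mu (trans (renT-subT _ _ t) (subT-cong (liftσs-ʳ∘ˢ ρ σ) t))
  renT-subT ρ σ (proc p)    = cong proc (renP-subP ρ σ p)
  renT-subT ρ σ (proj v l)  = cong (λ w → proj w l) (renV-subV ρ σ v)
  renT-subT ρ σ (case v bs) = cong₂ case (renV-subV ρ σ v) (renB-subB ρ σ bs)
  renT-subT ρ σ (delta v w) = cong₂ delta (renV-subV ρ σ v) (renV-subV ρ σ w)

  renB-subB : ∀ ρ σ bs → renB ρ (subB σ bs) ≡ subB (ρ ʳ∘ˢ σ) bs
  renB-subB ρ σ bnil           = refl
  renB-subB ρ σ (bcons c t bs) =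
    cong₂ (bcons c) (trans (renT-subT _ _ t) (subT-cong (liftσλ-ʳ∘ˢ ρ σ) t)) (renB-subB ρ σ bs)

  renS-subS : ∀ ρ σ π → renS ρ (subS σ π) ≡ subS (ρ ʳ∘ˢ σ) π
  renS-subS ρ σ (svar α)    = refl
  renS-subS ρ σ (push v π)  = cong₂ push (renV-subV ρ σ v) (renS-subS ρ σ π)
  renS-subS ρ σ (frame t π) = cong₂ frame (renT-subT ρ σ t) (renS-subS ρ σ π)

  renP-subP : ∀ ρ σ p → renP ρ (subP σ p) ≡ subP (ρ ʳ∘ˢ σ) p
  renP-subP ρ σ (t ∗ π) = cong₂ _∗_ (renT-subT ρ σ t) (renS-subS ρ σ π)

_ˢ∘ʳ_ : Subst → Ren → Subst
σ ˢ∘ʳ ρ = record { sλ = λ n → sλ σ (rλ ρ n) ; ss = λ n → ss σ (rs ρ n) ; st = st σ }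

liftσλ-ˢ∘ʳ : ∀ σ ρ → (liftσλ σ ˢ∘ʳ liftRλ ρ) ≗ˢ liftσλ (σ ˢ∘ʳ ρ)
liftσλ-ˢ∘ʳ σ ρ = record
  { sλ≗ = λ { zero → refl ; (suc n) → refl } ; ss≗ = λ _ → refl ; st≗ = λ _ → refl }

liftσs-ˢ∘ʳ : ∀ σ ρ → (liftσs σ ˢ∘ʳ liftRs ρ) ≗ˢ liftσs (σ ˢ∘ʳ ρ)
liftσs-ˢ∘ʳ σ ρ = record
  { sλ≗ = λ _ → refl ; ss≗ = λ { zero → refl ; (suc n) → refl } ; st≗ = λ _ → refl }

mutual
  subV-renV : ∀ σ ρ v → subV σ (renV ρ v) ≡ subV (σ ˢ∘ʳ ρ) v
  subV-renV σ ρ (var x)   = refl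
  subV-renV σ ρ (lam t)   = cong lam (trans (subT-renT _ _ t) (subT-cong (liftσλ-ˢ∘ʳ σ ρ) t))
  subV-renV σ ρ (con c v) = cong (con c) (subV-renV σ ρ v)
  subV-renV σ ρ (rec fs)  = cong rec (subF-renF σ ρ fs)

  subF-renF : ∀ σ ρ fs → subF σ (renF ρ fs) ≡ subF (σ ˢ∘ʳ ρ) fs
  subF-renF σ ρ fnil          = refl
  subF-renF σ ρ (fcons l v f) = cong₂ (fcons l) (subV-renV σ ρ v) (subF-renF σ ρ f)

  subT-renT : ∀ σ ρ t → subT σ (renT ρ t) ≡ subT (σ ˢ∘ʳ ρ) t
  subT-renT σ ρ (tvar a)    = refl
  subT-renT σ ρ (val v)     = cong val (subV-renV σ ρ v)
  subT-renT σ ρ (app t u)   = cong₂ app (subT-renT σ ρ t) (subT-renT σ ρ u)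
  subT-renT σ ρ (mu t)      = cong mu (trans (subT-renT _ _ t) (subT-cong (liftσs-ˢ∘ʳ σ ρ) t))
  subT-renT σ ρ (proc p)    = cong proc (subP-renP σ ρ p)
  subT-renT σ ρ (proj v l)  = cong (λ w → proj w l) (subV-renV σ ρ v)
  subT-renT σ ρ (case v bs) = cong₂ case (subV-renV σ ρ v) (subB-renB σ ρ bs)
  subT-renT σ ρ (delta v w) = cong₂ delta (subV-renV σ ρ v) (subV-renV σ ρ w)

  subB-renB : ∀ σ ρ bs → subB σ (renB ρ bs) ≡ subB (σ ˢ∘ʳ ρ) bs
  subB-renB σ ρ bnil           = refl
  subB-renB σ ρ (bcons c t bs) =
    cong₂ (bcons c) (trans (subT-renT _ _ t) (subT-cong (liftσλ-ˢ∘ʳ σ ρ) t)) (subB-renB σ ρ bs)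

  subS-renS : ∀ σ ρ π → subS σ (renS ρ π) ≡ subS (σ ˢ∘ʳ ρ) π
  subS-renS σ ρ (svar α)    = refl
  subS-renS σ ρ (push v π)  = cong₂ push (subV-renV σ ρ v) (subS-renS σ ρ π)
  subS-renS σ ρ (frame t π) = cong₂ frame (subT-renT σ ρ t) (subS-renS σ ρ π)

  subP-renP : ∀ σ ρ p → subP σ (renP ρ p) ≡ subP (σ ˢ∘ʳ ρ) p
  subP-renP σ ρ (t ∗ π) = cong₂ _∗_ (subT-renT σ ρ t) (subS-renS σ ρ π)

module _ {σ σ′ : Subst} {ρ ρ′ : Ren} (square : (σ ˢ∘ʳ ρ) ≗ˢ (ρ′ ʳ∘ˢ σ′)) where

  subV-renV-square : ∀ v → subV σ (renV ρ v) ≡ renV ρ′ (subV σ′ v)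
  subV-renV-square v = trans (subV-renV _ _ v) (trans (subV-cong square v) (sym (renV-subV _ _ v)))

  subS-renS-square : ∀ π → subS σ (renS ρ π) ≡ renS ρ′ (subS σ′ π)
  subS-renS-square π = trans (subS-renS _ _ π) (trans (subS-cong square π) (sym (renS-subS _ _ π)))

  subT-renT-square : ∀ t → subT σ (renT ρ t) ≡ renT ρ′ (subT σ′ t)
  subT-renT-square t = trans (subT-renT _ _ t) (trans (subT-cong square t) (sym (renT-subT _ _ t)))

_∘ˢ_ : Subst → Subst → Subst
σ ∘ˢ τ = record
  { sλ = λ n → subV σ (sλ τ n) ; ss = λ n → subS σ (ss τ n) ; st = λ a → subT σ (st τ a) }

liftσλ-∘ˢ : ∀ σ τ → (liftσλ σ ∘ˢ liftσλ τ) ≗ˢ liftσλ (σ ∘ˢ τ)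
liftσλ-∘ˢ σ τ = record
  { sλ≗ = λ { zero → refl ; (suc n) → subV-renV-square weaken (sλ τ n) }
  ; ss≗ = λ n → subS-renS-square weaken (ss τ n)
  ; st≗ = λ a → subT-renT-square weaken (st τ a) }
  where
  weaken : (liftσλ σ ˢ∘ʳ wkλ) ≗ˢ (wkλ ʳ∘ˢ σ)
  weaken = record { sλ≗ = λ _ → refl ; ss≗ = λ _ → refl ; st≗ = λ _ → refl }

liftσs-∘ˢ : ∀ σ τ → (liftσs σ ∘ˢ liftσs τ) ≗ˢ liftσs (σ ∘ˢ τ)
liftσs-∘ˢ σ τ = record
  { sλ≗ = λ n → subV-renV-square weaken (sλ τ n)
  ; ss≗ = λ { zero → refl ; (suc n) → subS-renS-square weaken (ss τ n) }
  ; st≗ = λ a → subT-renT-square weaken (st τ a) }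
  where
  weaken : (liftσs σ ˢ∘ʳ wks) ≗ˢ (wks ʳ∘ˢ σ)
  weaken = record { sλ≗ = λ _ → refl ; ss≗ = λ _ → refl ; st≗ = λ _ → refl }

mutual
  subV-subV : ∀ σ τ v → subV σ (subV τ v) ≡ subV (σ ∘ˢ τ) v
  subV-subV σ τ (var x)   = refl
  subV-subV σ τ (lam t)   = cong lam (trans (subT-subT _ _ t) (subT-cong (liftσλ-∘ˢ σ τ) t))
  subV-subV σ τ (con c v) = cong (con c) (subV-subV σ τ v)
  subV-subV σ τ (rec fs)  = cong rec (subF-subF σ τ fs)

  subF-subF : ∀ σ τ fs → subF σ (subF τ fs) ≡ subF (σ ∘ˢ τ) fs
  subF-subF σ τ fnil          = refl
  subF-subF σ τ (fcons l v f) = cong₂ (fcons l) (subV-subV σ τ v) (subF-subF σ τ f)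

  subT-subT : ∀ σ τ t → subT σ (subT τ t) ≡ subT (σ ∘ˢ τ) t
  subT-subT σ τ (tvar a)    = refl
  subT-subT σ τ (val v)     = cong val (subV-subV σ τ v)
  subT-subT σ τ (app t u)   = cong₂ app (subT-subT σ τ t) (subT-subT σ τ u)
  subT-subT σ τ (mu t)      = cong mu (trans (subT-subT _ _ t) (subT-cong (liftσs-∘ˢ σ τ) t))
  subT-subT σ τ (proc p)    = cong proc (subP-subP σ τ p)
  subT-subT σ τ (proj v l)  = cong (λ w → proj w l) (subV-subV σ τ v)
  subT-subT σ τ (case v bs) = cong₂ case (subV-subV σ τ v) (subB-subB σ τ bs)
  subT-subT σ τ (delta v w) = cong₂ delta (subV-subV σ τ v) (subV-subV σ τ w)

  subB-subB : ∀ σ τ bs → subB σ (subB τ bs) ≡ subB (σ ∘ˢ τ) bs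
  subB-subB σ τ bnil           = refl
  subB-subB σ τ (bcons c t bs) =
    cong₂ (bcons c) (trans (subT-subT _ _ t) (subT-cong (liftσλ-∘ˢ σ τ) t)) (subB-subB σ τ bs)

  subS-subS : ∀ σ τ π → subS σ (subS τ π) ≡ subS (σ ∘ˢ τ) π
  subS-subS σ τ (svar α)    = refl
  subS-subS σ τ (push v π)  = cong₂ push (subV-subV σ τ v) (subS-subS σ τ π)
  subS-subS σ τ (frame t π) = cong₂ frame (subT-subT σ τ t) (subS-subS σ τ π)

  subP-subP : ∀ σ τ p → subP σ (subP τ p) ≡ subP (σ ∘ˢ τ) p
  subP-subP σ τ (t ∗ π) = cong₂ _∗_ (subT-subT σ τ t) (subS-subS σ τ π)

idˢ : Subst
idˢ = record { sλ = var ; ss = svar ; st = tvar }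

liftσλ-id : liftσλ idˢ ≗ˢ idˢ
liftσλ-id = record
  { sλ≗ = λ { zero → refl ; (suc n) → refl } ; ss≗ = λ _ → refl ; st≗ = λ _ → refl }

liftσs-id : liftσs idˢ ≗ˢ idˢ
liftσs-id = record
  { sλ≗ = λ _ → refl ; ss≗ = λ { zero → refl ; (suc n) → refl } ; st≗ = λ _ → refl }

mutual
  subV-id : ∀ v → subV idˢ v ≡ v
  subV-id (var x)   = refl
  subV-id (lam t)   = cong lam (trans (subT-cong liftσλ-id t) (subT-id t))
  subV-id (con c v) = cong (con c) (subV-id v)
  subV-id (rec fs)  = cong rec (subF-id fs)

  subF-id : ∀ fs → subF idˢ fs ≡ fs
  subF-id fnil          = refl
  subF-id (fcons l v f) = cong₂ (fcons l) (subV-id v) (subF-id f)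

  subT-id : ∀ t → subT idˢ t ≡ t
  subT-id (tvar a)    = refl
  subT-id (val v)     = cong val (subV-id v)
  subT-id (app t u)   = cong₂ app (subT-id t) (subT-id u)
  subT-id (mu t)      = cong mu (trans (subT-cong liftσs-id t) (subT-id t))
  subT-id (proc p)    = cong proc (subP-id p)
  subT-id (proj v l)  = cong (λ w → proj w l) (subV-id v)
  subT-id (case v bs) = cong₂ case (subV-id v) (subB-id bs)
  subT-id (delta v w) = cong₂ delta (subV-id v) (subV-id w)

  subB-id : ∀ bs → subB idˢ bs ≡ bs
  subB-id bnil           = refl
  subB-id (bcons c t bs) = cong₂ (bcons c) (trans (subT-cong liftσλ-id t) (subT-id t)) (subB-id bs)

  subS-id : ∀ π → subS idˢ π ≡ π
  subS-id (svar α)    = refl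
  subS-id (push v π)  = cong₂ push (subV-id v) (subS-id π)
  subS-id (frame t π) = cong₂ frame (subT-id t) (subS-id π)

  subP-id : ∀ p → subP idˢ p ≡ p
  subP-id (t ∗ π) = cong₂ _∗_ (subT-id t) (subS-id π)

-- The substitution inside _[0≔_] is an anonymous pattern lambda, which is not
-- definitionally equal to any written elsewhere; [0≔]-sub0 names it.
sub0 : Val → Subst
sub0 v = record { sλ = λ { zero → v ; (suc n) → var n } ; ss = svar ; st = tvar }

[0≔]-sub0 : ∀ t v → t [0≔ v ] ≡ subT (sub0 v) t
[0≔]-sub0 t v = subT-cong
  (record { sλ≗ = λ { zero → refl ; (suc n) → refl } ; ss≗ = λ _ → refl ; st≗ = λ _ → refl }) t

sub0-∘ˢ : ∀ σ v → (σ ∘ˢ sub0 v) ≗ˢ (sub0 (subV σ v) ∘ˢ liftσλ σ)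
sub0-∘ˢ σ v = record
  { sλ≗ = λ { zero → refl ; (suc n) → sym (trans (subV-renV _ _ (sλ σ n)) (subV-id (sλ σ n))) }
  ; ss≗ = λ n → sym (trans (subS-renS _ _ (ss σ n)) (subS-id (ss σ n)))
  ; st≗ = λ a → sym (trans (subT-renT _ _ (st σ a)) (subT-id (st σ a))) }

subT-[0≔] : ∀ σ t v → subT σ (t [0≔ v ]) ≡ subT (liftσλ σ) t [0≔ subV σ v ]
subT-[0≔] σ t v = begin
  subT σ (t [0≔ v ])                            ≡⟨ cong (subT σ) ([0≔]-sub0 t v) ⟩
  subT σ (subT (sub0 v) t)                      ≡⟨ subT-subT σ (sub0 v) t ⟩
  subT (σ ∘ˢ sub0 v) t                          ≡⟨ subT-cong (sub0-∘ˢ σ v) t ⟩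
  subT (sub0 (subV σ v) ∘ˢ liftσλ σ) t          ≡⟨ subT-subT _ _ t ⟨
  subT (sub0 (subV σ v)) (subT (liftσλ σ) t)    ≡⟨ [0≔]-sub0 (subT (liftσλ σ) t) (subV σ v) ⟨
  subT (liftσλ σ) t [0≔ subV σ v ]              ∎
  where open ≡-Reasoning

infix 3 _≻!_
_≻!_ : Proc → Proc → Set
p ≻! q = p ≻ q × (∀ {q′} → p ≻ q′ → q′ ≡ q)

≻⇒Step : ∀ j {p q} → p ≻ q → Step j p q
≻⇒Step zero    r = r
≻⇒Step (suc j) r = inj₁ (≻⇒Step j r)

-- No ≻-rule applies to a δ-redex, so from a ≻-redex every ↝ⱼ-step is a ≻-step.
Step⇒≻ : ∀ j {p q q′} → p ≻ q → Step j p q′ → p ≻ q′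
Step⇒≻ zero    r s          = s
Step⇒≻ (suc j) r (inj₁ s)   = Step⇒≻ j r s
Step⇒≻ (suc j) () (inj₂ (dstep _))

≻-¬Final : ∀ {p q} → p ≻ q → ¬ Final p
≻-¬Final () (final v α)

≻!-Halts : ∀ j {p q} → p ≻! q → Halts (Step j) p ⇔ Halts (Step j) q
≻!-Halts j {p} {q} (r , unique) = mk⇔ forward backward
  where
  forward : Halts (Step j) p → Halts (Step j) q
  forward (_ , ε , f)      = ⊥-elim (≻-¬Final r f)
  forward (o , s ◅ ss , f) with unique (Step⇒≻ j r s)
  ... | refl = o , ss , f

  backward : Halts (Step j) q → Halts (Step j) p
  backward (o , ss , f) = o , ≻⇒Step j r ◅ ss , f

≻!*-Halts : ∀ j {p q} → Star _≻!_ p q → Halts (Step j) p ⇔ Halts (Step j) q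
≻!*-Halts j ε        = ⇔-id _
≻!*-Halts j (s ◅ ss) = ≻!*-Halts j ss ⇔-∘ ≻!-Halts j s

≡obs-if-≻!* : ∀ {t u} → (∀ σ π → Star _≻!_ (subT σ t ∗ π) (subT σ u ∗ π)) → t ≡obs u
≡obs-if-≻!* {t} {u} h i =
  Equivalence.from (Equiv-spec i t u) (λ j _ π σ → ≻!*-Halts j (h σ π))

β-≻!* : ∀ t v π → Star _≻!_ (app (val (lam t)) (val v) ∗ π) (t [0≔ v ] ∗ π)
β-≻!* t v π =
  (≻-app , λ { ≻-app → refl }) ◅ (≻-ret , λ { ≻-ret → refl }) ◅ (≻-beta , λ { ≻-beta → refl }) ◅ ε

branches-∈ : ∀ {n} (Cs : Vec ℕ n) ts k → lookup Cs k ↦ lookup ts k ∈B branches Cs ts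
branches-∈ (c ∷ Cs) (t ∷ ts) zero    = here
branches-∈ (c ∷ Cs) (t ∷ ts) (suc k) = there (branches-∈ Cs ts k)

branches-∈-constructor : ∀ {n} (Cs : Vec ℕ n) ts {c t} →
  c ↦ t ∈B branches Cs ts → ∃ λ k → lookup Cs k ≡ c
branches-∈-constructor []       []       ()
branches-∈-constructor (c ∷ Cs) (t ∷ ts) here      = zero , refl
branches-∈-constructor (c ∷ Cs) (t ∷ ts) (there m) with branches-∈-constructor Cs ts m
... | k , e = suc k , e

branches-∈-unique : ∀ {n} (Cs : Vec ℕ n) ts k {t} → Injective _≡_ _≡_ (lookup Cs) →
  lookup Cs k ↦ t ∈B branches Cs ts → t ≡ lookup ts k
branches-∈-unique (c ∷ Cs) (t ∷ ts) zero    inj here = refl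
branches-∈-unique (c ∷ Cs) (t ∷ ts) zero    inj (there m) with branches-∈-constructor Cs ts m
... | k , e with inj {suc k} {zero} e
... | ()
branches-∈-unique (c ∷ Cs) (t ∷ ts) (suc k) inj here with inj {suc k} {zero} refl
... | ()
branches-∈-unique (c ∷ Cs) (t ∷ ts) (suc k) inj (there m) =
  branches-∈-unique Cs ts k (λ e → suc-injective (inj e)) m

case-≻! : ∀ {n} (Cs : Vec ℕ n) ts v k π → Injective _≡_ _≡_ (lookup Cs) →
  case (con (lookup Cs k) v) (branches Cs ts) ∗ π ≻! lookup ts k [0≔ v ] ∗ π
case-≻! Cs ts v k π inj =
  ≻-case (branches-∈ Cs ts k) ,
  λ { (≻-case m) → cong (λ t → t [0≔ v ] ∗ π) (branches-∈-unique Cs ts k inj m) }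

subB-branches : ∀ σ {n} (Cs : Vec ℕ n) ts →
  subB σ (branches Cs ts) ≡ branches Cs (map (subT (liftσλ σ)) ts)
subB-branches σ []       []       = refl
subB-branches σ (c ∷ Cs) (t ∷ ts) = cong (bcons c _) (subB-branches σ Cs ts)

theorem10 : (∀ (t : Term) (v : Val) → app (val (lam t)) (val v) ≡obs (t [0≔ v ]))
    × (∀ (n : ℕ) (Cs : Vec ℕ n) (ts : Vec Term n) (v : Val) (k : Fin n)
    → Injective _≡_ _≡_ (lookup Cs)
    → case (con (lookup Cs k) v) (branches Cs ts) ≡obs (lookup ts k [0≔ v ]))
theorem10 = β , κ
  where
  β : ∀ t v → app (val (lam t)) (val v) ≡obs (t [0≔ v ])
  β t v = ≡obs-if-≻!* λ σ π →
    subst (λ r → Star _≻!_ (subT σ (app (val (lam t)) (val v)) ∗ π) (r ∗ π)) (sym (subT-[0≔] σ t v))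
      (β-≻!* (subT (liftσλ σ) t) (subV σ v) π)

  κ : ∀ n (Cs : Vec ℕ n) ts v k → Injective _≡_ _≡_ (lookup Cs) →
      case (con (lookup Cs k) v) (branches Cs ts) ≡obs (lookup ts k [0≔ v ])
  κ n Cs ts v k inj = ≡obs-if-≻!* λ σ π →
    subst₂ (λ bs r → Star _≻!_ (case (con (lookup Cs k) (subV σ v)) bs ∗ π) (r ∗ π))
      (sym (subB-branches σ Cs ts))
      (trans (cong (_[0≔ subV σ v ]) (lookup-map k _ ts)) (sym (subT-[0≔] σ (lookup ts k) v)))
      (case-≻! Cs _ (subV σ v) k π inj ◅ ε)
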